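{- Let $G$ be a $2$-connected chordal graph with threshold function $\theta$ satisfying $\theta(u)\le 2$ for every $u\in V(G)$. Fix a vertex $v$ of $G$ and let $\theta_1$ be the threshold function on $G-v$ given by $\theta_1(x)=\theta(x)-1$ for $x\in N_G(v)$ and $\theta_1(x)=\theta(x)$ otherwise. Let $\mathcal{F}$ be the set of optimal target sets $S$ for $(G-v,\theta_1)$ that maximize $|N_G(v)\cap [S]^G_\theta|$ among all optimal target sets for $(G-v,\theta_1)$. Let $I=\{u\in V(G-v):\theta_1(u)\le 0\}$, $J=\{u\in V(G):\theta(u)<2\}$, $J_0=\{u\in V(G):\theta(u)\le 0\}$. Let $\mathcal{P}_1$ (resp. $\mathcal{Q}_1$) be the property that there are two distinct vertices $x,y\in I$ (resp. $x,y\in J_0$) with $d_G(x,y)\le 2$. Let $\mathcal{P}_2$ (resp. $\mathcal{Q}_2$) be the property that there is an edge $xy$ of $G-v$ (resp. of $G$) with $x\in I$ and $\theta_1(y)=1$ (resp. $x\in J_0$ and $\theta(y)=1$). Then: (a) If $I\cap N_G(v)\neq\emptyset$, then $\emptyset\in\mathcal{F}$. (b) If $I\cap N_G(v)=\emptyset$ and $\mathcal{P}_1$ holds, then $\emptyset\in\mathcal{F}$. (c) If $I\cap N_G(v)=\emptyset$ and $\mathcal{P}_2$ holds, then $\emptyset\in\mathcal{F}$. (d) If $J=\emptyset$, then $\{x\}\in\mathcal{F}$ and $[\{x\}]^G_\theta=\{x\}$ for every $x\in N_G(v)$. (e) If $J\neq\emptyset$, $I\cap N_G(v)=\emptyset$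 and neither $\mathcal{P}_1$ nor $\mathcal{P}_2$ holds, then $\{x\}\in\mathcal{F}$ and $[\{x\}]^G_\theta=V(G)$ for every vertex $x$ adjacent to some vertex $w\in J$. (f) If $\mathcal{Q}_1$ or $\mathcal{Q}_2$ holds, then $[\emptyset]^G_\theta=V(G)$. (g) If neither $\mathcal{Q}_1$ nor $\mathcal{Q}_2$ holds, then $[\emptyset]^G_\theta=J_0$.
   Context: A graph is chordal if it has no induced cycle of length greater than three. For a finite simple graph $H$ with threshold function $\theta:V(H)\to\mathbb{Z}$ and a target set $S\subseteq V(H)$, the activation process is: at time $0$ the vertices of $S$ are active and all others inactive; at each subsequent time step, every inactive vertex $u$ having at least $\theta(u)$ active neighbours becomes active (so an inactive vertex with $\theta(u)\le 0$ becomes active at the next step). The process stops when no more vertices become active; $[S]^H_\theta$ denotes the set of active vertices at the end. $\text{min-seed}(H,\theta)=\min\{|S|: [S]^H_\theta=V(H)\}$, and an optimal target set for $(H,\theta)$ is a set $S$ with $[S]^H_\theta=V(H)$ and $|S|=\text{min-seed}(H,\theta)$. $d_G(x,y)$ is the distance in $G$, $N_G(v)$ the neighbourhood of $v$, and $G-v$ the subgraph induced by $V(G)\setminus\{v\}$. -}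

module Defs where

open import Data.Bool using (Bool; true; false; _∨_; if_then_else_)
open import Data.Nat as ℕ using (ℕ; zero; suc; _%_)
open import Data.Integer as ℤ using (ℤ; +_; _≤ᵇ_; _-_; 1ℤ; 0ℤ)
open import Data.Fin using (Fin; toℕ; punchIn; punchOut; _≟_)
open import Data.Fin.Subset as Sub using (Subset; ∣_∣; _∩_; ⁅_⁆) renaming (⊤ to Full; ⊥ to Empty)
open import Data.Vec using (Vec; tabulate; lookup)
open import Data.Product using (Σ; ∃; ∃-syntax; _×_; _,_)
open import Data.Sum using (_⊎_)
open import Relation.Nullary using (¬_; yes; no; Dec)
open import Relation.Binary.PropositionalEquality using (_≡_; _≢_)
open import Function.Definitions using (Injective)

record Graph (n : ℕ) : Set where
  field
    adj    : Fin n → Fin n → Bool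
    sym    : ∀ i j → adj i j ≡ adj j i
    irrefl : ∀ i → adj i i ≡ false
open Graph public

Edge : ∀ {n} → Graph n → Fin n → Fin n → Set
Edge G x y = adj G x y ≡ true

N : ∀ {n} → Graph n → Fin n → Subset n
N G v = tabulate (adj G v)

-- G - v : the subgraph induced by V(G) \ {v}; vertex i of G - v is
-- the vertex punchIn v i of G
_─_ : ∀ {n} → Graph (suc n) → Fin (suc n) → Graph n
adj    (G ─ v) i j = adj G (punchIn v i) (punchIn v j)
sym    (G ─ v) i j = sym G (punchIn v i) (punchIn v j)
irrefl (G ─ v) i   = irrefl G (punchIn v i)

-- a subset of V(G - v) seen as a subset of V(G) (v itself is outside)
embAt : ∀ {n} → (v : Fin (suc n)) → Subset n → (j : Fin (suc n)) → Dec (v ≡ j) → Bool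
embAt v S j (yes _)  = false
embAt v S j (no v≢j) = lookup S (punchOut v≢j)

emb : ∀ {n} → Fin (suc n) → Subset n → Subset (suc n)
emb v S = tabulate λ j → embAt v S j (v ≟ j)

data Walk {n} (G : Graph n) : Fin n → Fin n → ℕ → Set where
  nil  : ∀ {x} → Walk G x x 0
  cons : ∀ {x y z k} → Edge G x y → Walk G y z k → Walk G x z (suc k)

DistLe : ∀ {n} → Graph n → ℕ → Fin n → Fin n → Set
DistLe G k x y = ∃[ m ] (m ℕ.≤ k × Walk G x y m)

Connected : ∀ {n} → Graph n → Set
Connected G = ∀ x y → ∃[ k ] Walk G x y k

-- 2-connected (Diestel): more than 2 vertices, and G - X connected for
-- every X with |X| < 2, i.e. G connected and G - v connected for all v
TwoConnected : ∀ {n} → Graph (suc n) → Set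
TwoConnected {n} G = 3 ℕ.≤ suc n × Connected G × (∀ v → Connected (G ─ v))

CycNext : ∀ {k} → Fin k → Fin k → Set
CycNext {k} i j = (toℕ j ≡ suc (toℕ i)) ⊎ (suc (toℕ i) ≡ k × toℕ j ≡ 0)

CycAdj : ∀ {k} → Fin k → Fin k → Set
CycAdj i j = CycNext i j ⊎ CycNext j i

InducedCycle : ∀ {n} → Graph n → (k : ℕ) → Set
InducedCycle {n} G k =
  Σ (Fin k → Fin n) λ c → Injective _≡_ _≡_ c ×
    (∀ i j → (Edge G (c i) (c j) → CycAdj i j) × (CycAdj i j → Edge G (c i) (c j)))

Chordal : ∀ {n} → Graph n → Set
Chordal G = ∀ k → 3 ℕ.< k → ¬ InducedCycle G k

Threshold : ℕ → Set
Threshold n = Fin n → ℤ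

step : ∀ {n} → Graph n → Threshold n → Subset n → Subset n
step G θ A = tabulate λ u → lookup A u ∨ (θ u ≤ᵇ + ∣ N G u ∩ A ∣)

activeAt : ∀ {n} → Graph n → Threshold n → Subset n → ℕ → Subset n
activeAt G θ S zero    = S
activeAt G θ S (suc t) = step G θ (activeAt G θ S t)

-- [S]^G_θ : the final active set.  With n vertices the process has
-- stopped after at most n steps (each non-final step activates at
-- least one new vertex), so this is the active set at time n.
closure : ∀ {n} → Graph n → Threshold n → Subset n → Subset n
closure {n} G θ S = activeAt G θ S n

IsTarget : ∀ {n} → Graph n → Threshold n → Subset n → Set
IsTarget G θ S = closure G θ S ≡ Full

Optimal : ∀ {n} → Graph n → Threshold n → Subset n → Set
Optimal G θ S = IsTarget G θ S × (∀ S′ → IsTarget G θ S′ → ∣ S ∣ ℕ.≤ ∣ S′ ∣)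

θ₁ : ∀ {n} → Graph (suc n) → Threshold (suc n) → (v : Fin (suc n)) → Threshold n
θ₁ G θ v x = if adj G v (punchIn v x) then θ (punchIn v x) - 1ℤ else θ (punchIn v x)

InF : ∀ {n} → Graph (suc n) → Threshold (suc n) → Fin (suc n) → Subset n → Set
InF G θ v S = Optimal (G ─ v) (θ₁ G θ v) S ×
  (∀ S′ → Optimal (G ─ v) (θ₁ G θ v) S′ →
     ∣ N G v ∩ closure G θ (emb v S′) ∣ ℕ.≤ ∣ N G v ∩ closure G θ (emb v S) ∣)

InI : ∀ {n} → Graph (suc n) → Threshold (suc n) → Fin (suc n) → Fin n → Set
InI G θ v u = θ₁ G θ v u ℤ.≤ 0ℤ

InJ : ∀ {n} → Threshold n → Fin n → Set
InJ θ u = θ u ℤ.< + 2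

InJ₀ : ∀ {n} → Threshold n → Fin n → Set
InJ₀ θ u = θ u ℤ.≤ 0ℤ

J₀ : ∀ {n} → Threshold n → Subset n
J₀ θ = tabulate λ u → θ u ≤ᵇ 0ℤ

INvNonempty : ∀ {n} → Graph (suc n) → Threshold (suc n) → Fin (suc n) → Set
INvNonempty G θ v = ∃[ x ] (Edge G v (punchIn v x) × InI G θ v x)

P₁ : ∀ {n} → Graph (suc n) → Threshold (suc n) → Fin (suc n) → Set
P₁ G θ v = ∃[ x ] ∃[ y ] (x ≢ y × InI G θ v x × InI G θ v y ×
                          DistLe G 2 (punchIn v x) (punchIn v y))

P₂ : ∀ {n} → Graph (suc n) → Threshold (suc n) → Fin (suc n) → Set
P₂ G θ v = ∃[ x ] ∃[ y ] (Edge (G ─ v) x y × InI G θ v x × θ₁ G θ v y ≡ 1ℤ)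

Q₁ : ∀ {n} → Graph n → Threshold n → Set
Q₁ G θ = ∃[ x ] ∃[ y ] (x ≢ y × InJ₀ θ x × InJ₀ θ y × DistLe G 2 x y)

Q₂ : ∀ {n} → Graph n → Threshold n → Set
Q₂ G θ = ∃[ x ] ∃[ y ] (Edge G x y × InJ₀ θ x × θ y ≡ 1ℤ)

module Submission where

-- Everything rests on a spreading theorem: in a 2-connected chordal graph, a vertex
-- set that contains both ends of some edge and contains every vertex having two
-- distinct neighbours in it is the whole vertex set.  The least such set B is the
-- closure of the edge under threshold 2, which is connected; a vertex outside B
-- yields, by 2-connectivity, an ear over B (a closed walk leaving B and re-entering
-- it elsewhere).  Cutting out repeated vertices and chords, a shortest ear is either
-- a triangle, whose tip would lie in B, or an induced cycle of length ≥ 4, which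
-- chordality forbids.
--
-- There the vertices of G lifted from an activation in G - v
-- form a two-neighbour-closed set, so (a)-(e) reduce to exhibiting one lifted edge.

open import Defs
open import Data.Bool using (Bool; true; false; _∨_) renaming (_≟_ to _≟ᵇ_)
open import Data.Bool.Properties using (∨-zeroʳ; T-≡)
open import Data.Nat as ℕ using (ℕ; zero; suc; z≤n; s≤s; _≤_; _<_; _+_; _∸_; _≤?_; _<?_)
import Data.Nat.Properties as ℕP
open import Data.Nat.Properties using (≤-refl; ≤-trans; <-≤-trans; ≤-<-trans; <⇒≤; anyUpTo?)
open import Data.Nat.Induction using (<-rec)
open import Data.Integer as ℤ using (ℤ; +_; -[1+_]; _-_; 1ℤ; 0ℤ; +≤+; -≤+)
import Data.Integer.Properties as ℤP
open import Data.Fin using (Fin; zero; suc; toℕ; punchIn; punchOut)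
open import Data.Fin.Properties
  using (any?; suc-injective; toℕ-injective; toℕ<n; punchInᵢ≢i; punchIn-punchOut; punchOut-punchIn; punchOut-cong;
         punchIn-injective)
  renaming (_≟_ to _≟F_)
open import Data.Fin.Subset using (Subset; ∣_∣; _∩_; _∪_; _∈_; _⊆_; _⊂_; ⁅_⁆) renaming (⊤ to Full; ⊥ to Empty)
import Data.Fin.Subset.Properties as SubP
open import Data.Vec using (_∷_; tabulate; lookup; here; there)
open import Data.Vec.Properties using (lookup∘tabulate; []=⇒lookup; lookup⇒[]=)
open import Data.Product using (∃; ∃-syntax; _×_; _,_; proj₁; proj₂)
open import Data.Sum using (_⊎_; inj₁; inj₂)
open import Data.Empty using (⊥; ⊥-elim)
open import Function.Bundles using (Equivalence)
open import Relation.Nullary using (¬_; yes; no; Dec)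
open import Relation.Binary.Definitions using (tri<; tri≈; tri>)
open import Relation.Nullary.Decidable using (_×-dec_; ¬?; decidable-stable)
open import Relation.Binary.PropositionalEquality using (_≡_; _≢_; refl; trans; cong; cong₂; subst; subst₂)
  renaming (sym to ≡-sym)

∈-tabulate⁺ : ∀ {n} {f : Fin n → Bool} {x} → f x ≡ true → x ∈ tabulate f
∈-tabulate⁺ {f = f} {x} fx = lookup⇒[]= x _ (trans (lookup∘tabulate f x) fx)

∈-tabulate⁻ : ∀ {n} {f : Fin n → Bool} {x} → x ∈ tabulate f → f x ≡ true
∈-tabulate⁻ {f = f} {x} x∈ = trans (≡-sym (lookup∘tabulate f x)) ([]=⇒lookup x∈)

edge-sym : ∀ {n} (G : Graph n) {x y} → Edge G x y → Edge G y x
edge-sym G {x} {y} e = trans (Graph.sym G y x) e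

∈N⁺ : ∀ {n} (G : Graph n) {v u} → Edge G v u → u ∈ N G v
∈N⁺ G = ∈-tabulate⁺

∈N⁻ : ∀ {n} (G : Graph n) {v u} → u ∈ N G v → Edge G v u
∈N⁻ G = ∈-tabulate⁻

edge-irrefl : ∀ {n} (G : Graph n) {x y} → Edge G x y → x ≢ y
edge-irrefl G {x} e refl with trans (≡-sym (Graph.irrefl G x)) e
... | ()

one≤∣p∣ : ∀ {n} {p : Subset n} {x} → x ∈ p → 1 ≤ ∣ p ∣
one≤∣p∣ x∈p = ℕP.≤-trans (s≤s z≤n) (SubP.x∈p⇒∣p-x∣<∣p∣ x∈p)

two≤∣p∣ : ∀ {n} {p : Subset n} {x y} → x ≢ y → x ∈ p → y ∈ p → 2 ≤ ∣ p ∣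
two≤∣p∣ x≢y x∈p y∈p =
  ℕP.≤-trans (s≤s (one≤∣p∣ (SubP.x∈p∧x≢y⇒x∈p-y y∈p (λ e → x≢y (≡-sym e))))) (SubP.x∈p⇒∣p-x∣<∣p∣ x∈p)

element : ∀ {n} (p : Subset n) → 1 ≤ ∣ p ∣ → ∃[ x ] x ∈ p
element (true ∷ p) _ = zero , here
element (false ∷ p) h with element p h
... | x , x∈p = suc x , there x∈p

two-elements : ∀ {n} (p : Subset n) → 2 ≤ ∣ p ∣ → ∃[ x ] ∃[ y ] (x ≢ y × x ∈ p × y ∈ p)
two-elements (true ∷ p) (s≤s h) with element p h
... | y , y∈p = zero , suc y , (λ ()) , here , there y∈p
two-elements (false ∷ p) h with two-elements p h
... | x , y , x≢y , x∈p , y∈p =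
  suc x , suc y , (λ e → x≢y (suc-injective e)) , there x∈p , there y∈p

∣p∣≡0⇒p≡∅ : ∀ {n} (p : Subset n) → ∣ p ∣ ≡ 0 → p ≡ Empty
∣p∣≡0⇒p≡∅ p ∣p∣≡0 = SubP.Empty-unique λ (x , x∈p) → ℕP.<⇒≢ (one≤∣p∣ x∈p) (≡-sym ∣p∣≡0)

∣p∣≤1 : ∀ {n} (p : Subset n) → (∀ {x y} → x ≢ y → x ∈ p → y ∈ p → ⊥) → ∣ p ∣ ≤ 1
∣p∣≤1 p single with ∣ p ∣ ℕ.≤? 1
... | yes le = le
... | no nle with two-elements p (ℕP.≰⇒> nle)
...   | x , y , x≢y , x∈p , y∈p = ⊥-elim (single x≢y x∈p y∈p)

⁅⁆-single : ∀ {n} (z : Fin n) {x y} → x ≢ y → x ∈ ⁅ z ⁆ → y ∈ ⁅ z ⁆ → ⊥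
⁅⁆-single z x≢y x∈ y∈ = x≢y (trans (SubP.x∈⁅y⁆⇒x≡y z x∈) (≡-sym (SubP.x∈⁅y⁆⇒x≡y z y∈)))

∩-⊆ʳ : ∀ {n} (p : Subset n) {q r} → q ⊆ r → p ∩ q ⊆ p ∩ r
∩-⊆ʳ p {q} q⊆r x∈ = let (x∈p , x∈q) = SubP.x∈p∩q⁻ p q x∈ in SubP.x∈p∩q⁺ (x∈p , q⊆r x∈q)

all⇒Full : ∀ {n} (p : Subset n) → (∀ x → x ∈ p) → p ≡ Full
all⇒Full p all = SubP.⊆-antisym SubP.⊆⊤ (λ {x} _ → all x)

Full⇒∈ : ∀ {n} {p : Subset n} → p ≡ Full → ∀ x → x ∈ p
Full⇒∈ refl x = SubP.∈⊤

step-lookup : ∀ {n} (G : Graph n) θ A u → lookup (step G θ A) u ≡ (lookup A u ∨ (θ u ℤ.≤ᵇ + ∣ N G u ∩ A ∣))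
step-lookup G θ A u = lookup∘tabulate _ u

step-⊇ : ∀ {n} (G : Graph n) θ A → A ⊆ step G θ A
step-⊇ G θ A {u} u∈A = lookup⇒[]= u _
  (trans (step-lookup G θ A u) (cong (_∨ (θ u ℤ.≤ᵇ + ∣ N G u ∩ A ∣)) ([]=⇒lookup u∈A)))

step-activates : ∀ {n} (G : Graph n) θ A u → θ u ℤ.≤ + ∣ N G u ∩ A ∣ → u ∈ step G θ A
step-activates G θ A u enough = lookup⇒[]= u _
  (trans (step-lookup G θ A u)
    (trans (cong (lookup A u ∨_) (Equivalence.to T-≡ (ℤP.≤⇒≤ᵇ enough))) (∨-zeroʳ (lookup A u))))

step-cases : ∀ {n} (G : Graph n) θ A u → u ∈ step G θ A → u ∈ A ⊎ θ u ℤ.≤ + ∣ N G u ∩ A ∣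
step-cases G θ A u u∈ with lookup A u in eqA | θ u ℤ.≤ᵇ + ∣ N G u ∩ A ∣ in eqθ
... | true  | _    = inj₁ (lookup⇒[]= u A eqA)
... | false | true = inj₂ (ℤP.≤ᵇ⇒≤ (Equivalence.from T-≡ eqθ))
... | false | false with trans (≡-sym (trans (step-lookup G θ A u) (cong₂ _∨_ eqA eqθ))) ([]=⇒lookup u∈)
...   | ()

step-mono : ∀ {n} (G : Graph n) θ {A B} → A ⊆ B → step G θ A ⊆ step G θ B
step-mono G θ {A} {B} A⊆B {u} u∈ with step-cases G θ A u u∈
... | inj₁ u∈A = step-⊇ G θ B (A⊆B u∈A)
... | inj₂ enough = step-activates G θ B u
  (ℤP.≤-trans enough (+≤+ (SubP.p⊆q⇒∣p∣≤∣q∣ (∩-⊆ʳ (N G u) A⊆B))))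

step-stable-or-grows : ∀ {n} (G : Graph n) θ A → step G θ A ≡ A ⊎ A ⊂ step G θ A
step-stable-or-grows G θ A with any? (λ x → SubP._∈?_ x (step G θ A) ×-dec ¬? (SubP._∈?_ x A))
... | yes (x , x∈ , x∉) = inj₂ (step-⊇ G θ A , x , x∈ , x∉)
... | no none = inj₁ (SubP.⊆-antisym
        (λ {x} x∈ → decidable-stable (SubP._∈?_ x A) (λ x∉ → none (x , x∈ , x∉))) (step-⊇ G θ A))

module Activation {n} (G : Graph n) (θ : Threshold n) (S : Subset n) where

  private
    A : ℕ → Subset n
    A = activeAt G θ S

  large-or-stopped : ∀ t → t ≤ ∣ A t ∣ ⊎ step G θ (A t) ≡ A t
  large-or-stopped zero = inj₁ z≤n
  large-or-stopped (suc t) with large-or-stopped t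
  ... | inj₂ stopped = inj₂ (subst (λ B → step G θ B ≡ B) (≡-sym stopped) stopped)
  ... | inj₁ t≤∣At∣ with step-stable-or-grows G θ (A t)
  ...   | inj₁ stopped = inj₂ (subst (λ B → step G θ B ≡ B) (≡-sym stopped) stopped)
  ...   | inj₂ grows   = inj₁ (ℕP.≤-trans (s≤s t≤∣At∣) (SubP.p⊂q⇒∣p∣<∣q∣ grows))

  closure-fixpoint : step G θ (closure G θ S) ≡ closure G θ S
  closure-fixpoint with large-or-stopped n
  ... | inj₂ stopped = stopped
  ... | inj₁ n≤∣An∣ = subst (λ B → step G θ B ≡ B) (≡-sym An≡Full) step-Full
    where
    An≡Full : A n ≡ Full
    An≡Full = SubP.∣p∣≡n⇒p≡⊤ (ℕP.≤-antisym (SubP.∣p∣≤n (A n)) n≤∣An∣)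
    step-Full : step G θ Full ≡ Full
    step-Full = SubP.⊆-antisym SubP.⊆⊤ (step-⊇ G θ Full)

  closure-closed : ∀ u → θ u ℤ.≤ + ∣ N G u ∩ closure G θ S ∣ → u ∈ closure G θ S
  closure-closed u enough = subst (u ∈_) closure-fixpoint (step-activates G θ _ u enough)

  activeAt-⊆-closure : ∀ t → A t ⊆ closure G θ S
  activeAt-⊆-closure zero = seeds-stay n
    where
    seeds-stay : ∀ m → S ⊆ A m
    seeds-stay zero x∈ = x∈
    seeds-stay (suc m) x∈ = step-⊇ G θ _ (seeds-stay m x∈)
  activeAt-⊆-closure (suc t) x∈ =
    subst (_ ∈_) closure-fixpoint (step-mono G θ (activeAt-⊆-closure t) x∈)

  S-⊆-closure : S ⊆ closure G θ S
  S-⊆-closure = activeAt-⊆-closure 0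

  closure-ind : (P : Fin n → Set) → (∀ {u} → u ∈ S → P u) →
    (∀ B u → B ⊆ closure G θ S → (∀ {w} → w ∈ B → P w) →
       u ∈ closure G θ S → θ u ℤ.≤ + ∣ N G u ∩ B ∣ → P u) →
    ∀ {u} → u ∈ closure G θ S → P u
  closure-ind P seeds inherit = along n
    where
    along : ∀ t {u} → u ∈ A t → P u
    along zero u∈ = seeds u∈
    along (suc t) {u} u∈ with step-cases G θ (A t) u u∈
    ... | inj₁ u∈At = along t u∈At
    ... | inj₂ enough =
      inherit (A t) u (activeAt-⊆-closure t) (along t) (activeAt-⊆-closure (suc t) u∈) enough

open Activation public

neighbour-in : ∀ {n} (G : Graph n) {u} (B : Subset n) {c : ℤ} →
  + 1 ℤ.≤ c → c ℤ.≤ + ∣ N G u ∩ B ∣ → ∃[ p ] (Edge G u p × p ∈ B)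
neighbour-in G {u} B 1≤c c≤ with element (N G u ∩ B) (ℤP.drop‿+≤+ (ℤP.≤-trans 1≤c c≤))
... | p , p∈ = let (p∈N , p∈B) = SubP.x∈p∩q⁻ (N G u) B p∈ in p , ∈N⁻ G p∈N , p∈B

two-neighbours-in : ∀ {n} (G : Graph n) {u} (B : Subset n) {c : ℤ} →
  + 2 ℤ.≤ c → c ℤ.≤ + ∣ N G u ∩ B ∣ →
  ∃[ p ] ∃[ q ] (p ≢ q × Edge G u p × p ∈ B × Edge G u q × q ∈ B)
two-neighbours-in G {u} B 2≤c c≤ with two-elements (N G u ∩ B) (ℤP.drop‿+≤+ (ℤP.≤-trans 2≤c c≤))
... | p , q , p≢q , p∈ , q∈ =
  let (p∈N , p∈B) = SubP.x∈p∩q⁻ (N G u) B p∈ ; (q∈N , q∈B) = SubP.x∈p∩q⁻ (N G u) B q∈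
  in p , q , p≢q , ∈N⁻ G p∈N , p∈B , ∈N⁻ G q∈N , q∈B

one-active-neighbour : ∀ {n} (G : Graph n) {u p} (B : Subset n) →
  Edge G u p → p ∈ B → + 1 ℤ.≤ + ∣ N G u ∩ B ∣
one-active-neighbour G B up p∈B = +≤+ (one≤∣p∣ (SubP.x∈p∩q⁺ (∈N⁺ G up , p∈B)))

two-active-neighbours : ∀ {n} (G : Graph n) {u p q} (B : Subset n) → p ≢ q →
  Edge G u p → p ∈ B → Edge G u q → q ∈ B → + 2 ℤ.≤ + ∣ N G u ∩ B ∣
two-active-neighbours G B p≢q up p∈B uq q∈B =
  +≤+ (two≤∣p∣ p≢q (SubP.x∈p∩q⁺ (∈N⁺ G up , p∈B)) (SubP.x∈p∩q⁺ (∈N⁺ G uq , q∈B)))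

module _ {n} (G : Graph n) where

  private
    V = Fin n
    E = Edge G

  -- the t-th vertex of a walk (the last one for t beyond its length)
  vertexAt : ∀ {x y k} → Walk G x y k → ℕ → V
  vertexAt {x} nil        _       = x
  vertexAt {x} (cons e w) zero    = x
  vertexAt     (cons e w) (suc t) = vertexAt w t

  vertexAt-start : ∀ {x y k} (w : Walk G x y k) → vertexAt w 0 ≡ x
  vertexAt-start nil        = refl
  vertexAt-start (cons e w) = refl

  vertexAt-end : ∀ {x y k} (w : Walk G x y k) → vertexAt w k ≡ y
  vertexAt-end nil        = refl
  vertexAt-end (cons e w) = vertexAt-end w

  vertexAt-edge : ∀ {x y k} (w : Walk G x y k) t → t < k → E (vertexAt w t) (vertexAt w (suc t))
  vertexAt-edge (cons e w) zero    _        = subst (E _) (≡-sym (vertexAt-start w)) e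
  vertexAt-edge (cons e w) (suc t) (s≤s lt) = vertexAt-edge w t lt

  _++ʷ_ : ∀ {x y z k l} → Walk G x y k → Walk G y z l → Walk G x z (k + l)
  nil       ++ʷ w = w
  cons e v  ++ʷ w = cons e (v ++ʷ w)

  vertexAt-++ˡ : ∀ {x y z k l} (v : Walk G x y k) (w : Walk G y z l) t → t ≤ k →
                 vertexAt (v ++ʷ w) t ≡ vertexAt v t
  vertexAt-++ˡ nil        w zero    _        = vertexAt-start w
  vertexAt-++ˡ (cons e v) w zero    _        = refl
  vertexAt-++ˡ (cons e v) w (suc t) (s≤s le) = vertexAt-++ˡ v w t le

  vertexAt-++ʳ : ∀ {x y z k l} (v : Walk G x y k) (w : Walk G y z l) t →
                 vertexAt (v ++ʷ w) (k + t) ≡ vertexAt w t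
  vertexAt-++ʳ nil        w t = refl
  vertexAt-++ʳ (cons e v) w t = vertexAt-++ʳ v w t

  data WalkIn (P : V → Set) : V → V → ℕ → Set where
    pnil  : ∀ {x} → P x → WalkIn P x x 0
    pcons : ∀ {x y z k} → P x → E x y → WalkIn P y z k → WalkIn P x z (suc k)

  walkIn⇒walk : ∀ {P x y k} → WalkIn P x y k → Walk G x y k
  walkIn⇒walk (pnil _)      = nil
  walkIn⇒walk (pcons _ e w) = cons e (walkIn⇒walk w)

  vertexAt-in : ∀ {P x y k} (w : WalkIn P x y k) t → t ≤ k → P (vertexAt (walkIn⇒walk w) t)
  vertexAt-in (pnil p)      t       _        = p
  vertexAt-in (pcons p e w) zero    _        = p
  vertexAt-in (pcons p e w) (suc t) (s≤s le) = vertexAt-in w t le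

  _++ⁱ_ : ∀ {P x y z k l} → WalkIn P x y k → WalkIn P y z l → WalkIn P x z (k + l)
  pnil _      ++ⁱ w = w
  pcons p e v ++ⁱ w = pcons p e (v ++ⁱ w)

  snocⁱ : ∀ {P x y z k} → WalkIn P x y k → E y z → P z → WalkIn P x z (suc k)
  snocⁱ (pnil p)       e q = pcons p e (pnil q)
  snocⁱ (pcons p e' w) e q = pcons p e' (snocⁱ w e q)

  reverseⁱ : ∀ {P x y k} → WalkIn P x y k → WalkIn P y x k
  reverseⁱ (pnil p)      = pnil p
  reverseⁱ (pcons p e w) = snocⁱ (reverseⁱ w) (edge-sym G e) p

  data WalkTo (P : V → Set) : V → V → ℕ → Set where
    oend  : ∀ {x} → P x → WalkTo P x x 0
    ostep : ∀ {x y z k} → ¬ P x → E x y → WalkTo P y z k → WalkTo P x z (suc k)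

  walkTo⇒walk : ∀ {P x y k} → WalkTo P x y k → Walk G x y k
  walkTo⇒walk (oend _)      = nil
  walkTo⇒walk (ostep _ e w) = cons e (walkTo⇒walk w)

  vertexAt-out : ∀ {P x y k} (w : WalkTo P x y k) t → t < k → ¬ P (vertexAt (walkTo⇒walk w) t)
  vertexAt-out (ostep np e w) zero    _        = np
  vertexAt-out (ostep np e w) (suc t) (s≤s lt) = vertexAt-out w t lt

  walkTo-end : ∀ {P x y k} → WalkTo P x y k → P y
  walkTo-end (oend p)      = p
  walkTo-end (ostep _ _ w) = walkTo-end w

  leaving-edge : ∀ {P : V → Set} → (∀ z → Dec (P z)) → ∀ {x y k} → Walk G x y k → P x → ¬ P y →
                 ∃[ a ] ∃[ u ] (P a × ¬ P u × E a u)
  leaving-edge P? nil px npy = ⊥-elim (npy px)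
  leaving-edge P? {x} (cons {y = y} e w) px npy with P? y
  ... | yes py = leaving-edge P? w py npy
  ... | no npy' = x , y , px , npy' , e

  first-hit : ∀ {P : V → Set} → (∀ z → Dec (P z)) → ∀ {x y k} → Walk G x y k → P y →
              ∃[ b ] ∃[ m ] WalkTo P x b m
  first-hit P? {x} nil py = x , 0 , oend py
  first-hit P? {x} (cons e w) py with P? x
  ... | yes px = x , 0 , oend px
  ... | no npx with first-hit P? w py
  ...   | b , m , w' = b , suc m , ostep npx e w'

walkTo-lift : ∀ {n} (G : Graph (suc n)) v {P : Fin (suc n) → Set} {i j k} →
              WalkTo (G ─ v) (λ z → P (punchIn v z)) i j k → WalkTo G P (punchIn v i) (punchIn v j) k
walkTo-lift G v (oend p)       = oend p
walkTo-lift G v (ostep np e w) = ostep np e (walkTo-lift G v w)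

TwoNeighbourClosed : ∀ {n} → Graph n → (Fin n → Set) → Set
TwoNeighbourClosed G C = ∀ u p q → p ≢ q → C p → C q → Edge G u p → Edge G u q → C u

module EarArgument {n} (G : Graph n) (B : Fin n → Set) (closedB : TwoNeighbourClosed G B) where

  private
    V = Fin n
    E = Edge G

  record Ear (M : ℕ) : Set where
    field
      f : ℕ → V
      k : ℕ
      2≤k : 2 ≤ k
      k≤M : k ≤ M
      edge : ∀ t → t < M → E (f t) (f (suc t))
      closing : E (f M) (f 0)
      outside : ∀ t → 1 ≤ t → t < k → ¬ B (f t)
      start∈B : B (f 0)
      tail∈B : ∀ t → k ≤ t → t ≤ M → B (f t)
      f₀≢fₖ : f 0 ≢ f k

  skip : (ℕ → V) → ℕ → ℕ → ℕ → V
  skip f i d t with t ≤? i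
  ... | yes _ = f t
  ... | no _ = f (t + d)

  skip-below : ∀ f i d t → t ≤ i → skip f i d t ≡ f t
  skip-below f i d t le with t ≤? i
  ... | yes _ = refl
  ... | no n = ⊥-elim (n le)

  skip-above : ∀ f i d t → i < t → skip f i d t ≡ f (t + d)
  skip-above f i d t lt with t ≤? i
  ... | yes le = ⊥-elim (ℕP.<⇒≱ lt le)
  ... | no _ = refl

  -- Shortcutting an ear: if f i is adjacent to f (i + d + 1) (or closes the walk
  -- when i = M'), removing the d vertices in between gives an ear of length M',
  -- wherever the re-entry index k lies relative to the removed stretch.
  module Shortcut {M} (e : Ear M) (i d M' : ℕ) (M≡M'+d : M ≡ M' + d) (i≤M' : i ≤ M')
             (bridge : i < M' → E (Ear.f e i) (Ear.f e (suc (i + d))))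
             (bridge-last : i ≡ M' → E (Ear.f e i) (Ear.f e 0)) where
    open Ear e
    g = skip f i d

    g₀ : g 0 ≡ f 0
    g₀ = skip-below f i d 0 z≤n

    start∈B' : B (g 0)
    start∈B' = subst B (≡-sym g₀) start∈B

    M'≤M : M' ≤ M
    M'≤M = ≤-trans (ℕP.m≤m+n M' d) (ℕP.≤-reflexive (≡-sym M≡M'+d))

    ≤M : ∀ {t} → t ≤ M' → t + d ≤ M
    ≤M {t} le = subst (t + d ≤_) (≡-sym M≡M'+d) (ℕP.+-monoˡ-≤ d le)

    edge' : ∀ t → t < M' → E (g t) (g (suc t))
    edge' t lt with ℕP.<-cmp t i
    ... | tri< t<i _ _ = subst₂ E (≡-sym (skip-below f i d t (<⇒≤ t<i))) (≡-sym (skip-below f i d (suc t) t<i))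
                           (edge t (<-≤-trans t<i (≤-trans i≤M' M'≤M)))
    ... | tri≈ _ refl _ = subst₂ E (≡-sym (skip-below f i d t ≤-refl)) (≡-sym (skip-above f i d (suc t) ≤-refl))
                            (bridge lt)
    ... | tri> _ _ i<t = subst₂ E (≡-sym (skip-above f i d t i<t)) (≡-sym (skip-above f i d (suc t) (ℕP.m<n⇒m<1+n i<t)))
                           (edge (t + d) (≤M lt))

    closing' : E (g M') (g 0)
    closing' with ℕP.m≤n⇒m<n∨m≡n i≤M'
    ... | inj₂ refl = subst₂ E (≡-sym (skip-below f i d i ≤-refl)) (≡-sym g₀) (bridge-last refl)
    ... | inj₁ lt = subst₂ E (≡-sym (trans (skip-above f i d M' lt) (cong f (≡-sym M≡M'+d)))) (≡-sym g₀) closing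

    shorten-before : ∀ k' → k ≡ k' + d → i < k' → 2 ≤ k' → Ear M'
    shorten-before k' k≡ i<k' 2≤k' = record
      { f = g ; k = k' ; 2≤k = 2≤k'
      ; k≤M = ℕP.+-cancelʳ-≤ d k' M' (subst₂ _≤_ k≡ M≡M'+d k≤M)
      ; edge = edge' ; closing = closing' ; outside = outside' ; start∈B = start∈B' ; tail∈B = tail∈B'
      ; f₀≢fₖ = λ e → f₀≢fₖ (trans (trans (≡-sym g₀) e) (trans (skip-above f i d k' i<k') (cong f (≡-sym k≡)))) }
      where
      outside' : ∀ t → 1 ≤ t → t < k' → ¬ B (g t)
      outside' t 1≤t t<k' with t ≤? i
      ... | yes _ = outside t 1≤t (subst (t <_) (≡-sym k≡) (ℕP.<-≤-trans t<k' (ℕP.m≤m+n k' d)))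
      ... | no _ = outside (t + d) (≤-trans 1≤t (ℕP.m≤m+n t d))
                     (subst (t + d <_) (≡-sym k≡) (ℕP.+-monoˡ-< d t<k'))
      tail∈B' : ∀ t → k' ≤ t → t ≤ M' → B (g t)
      tail∈B' t k'≤t t≤M' = subst B (≡-sym (skip-above f i d t (<-≤-trans i<k' k'≤t)))
        (tail∈B (t + d) (subst (_≤ t + d) (≡-sym k≡) (ℕP.+-monoˡ-≤ d k'≤t)) (≤M t≤M'))

    -- k lies inside the removed stretch; the new re-entry point is i + 1
    shorten-at : 1 ≤ i → i < k → k ≤ suc i + d → suc i ≤ M' → f 0 ≢ f (suc i + d) → Ear M'
    shorten-at 1≤i i<k k≤ i<M' f₀≢f' = record
      { f = g ; k = suc i ; 2≤k = s≤s 1≤i ; k≤M = i<M'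
      ; edge = edge' ; closing = closing' ; outside = outside' ; start∈B = start∈B' ; tail∈B = tail∈B'
      ; f₀≢fₖ = λ e → f₀≢f' (trans (trans (≡-sym g₀) e) (skip-above f i d (suc i) ≤-refl)) }
      where
      outside' : ∀ t → 1 ≤ t → t < suc i → ¬ B (g t)
      outside' t 1≤t (s≤s t≤i) =
        subst (λ x → ¬ B x) (≡-sym (skip-below f i d t t≤i)) (outside t 1≤t (≤-<-trans t≤i i<k))
      tail∈B' : ∀ t → suc i ≤ t → t ≤ M' → B (g t)
      tail∈B' t i<t t≤M' = subst B (≡-sym (skip-above f i d t i<t))
        (tail∈B (t + d) (≤-trans k≤ (ℕP.+-monoˡ-≤ d i<t)) (≤M t≤M'))

    shorten-after : k ≤ i → Ear M'
    shorten-after k≤i = record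
      { f = g ; k = k ; 2≤k = 2≤k ; k≤M = ≤-trans k≤i i≤M'
      ; edge = edge' ; closing = closing' ; outside = outside' ; start∈B = start∈B' ; tail∈B = tail∈B'
      ; f₀≢fₖ = λ e → f₀≢fₖ (trans (trans (≡-sym g₀) e) (skip-below f i d k k≤i)) }
      where
      outside' : ∀ t → 1 ≤ t → t < k → ¬ B (g t)
      outside' t 1≤t t<k =
        subst (λ x → ¬ B x) (≡-sym (skip-below f i d t (<⇒≤ (<-≤-trans t<k k≤i)))) (outside t 1≤t t<k)
      tail∈B' : ∀ t → k ≤ t → t ≤ M' → B (g t)
      tail∈B' t k≤t t≤M' with ℕP.≤-<-connex t i
      ... | inj₁ t≤i = subst B (≡-sym (skip-below f i d t t≤i)) (tail∈B t k≤t (≤-trans t≤M' M'≤M))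
      ... | inj₂ i<t = subst B (≡-sym (skip-above f i d t i<t))
                         (tail∈B (t + d) (≤-trans k≤t (ℕP.m≤m+n t d)) (≤M t≤M'))

  truncate : ∀ {M} (e : Ear M) M' → M' ≤ M → Ear.k e ≤ M' → E (Ear.f e M') (Ear.f e 0) → Ear M'
  truncate e M' le kM' c = record
    { f = f ; k = k ; 2≤k = 2≤k ; k≤M = kM' ; edge = λ t lt → edge t (<-≤-trans lt le) ; closing = c
    ; outside = outside ; start∈B = start∈B ; tail∈B = λ t kt tM → tail∈B t kt (≤-trans tM le)
    ; f₀≢fₖ = f₀≢fₖ }
    where open Ear e

  split-gap : ∀ M i j → i ≤ j → j ≤ M →
           (i + (j ∸ i) ≡ j) × (M ≡ (M ∸ (j ∸ i)) + (j ∸ i)) × (i ≤ M ∸ (j ∸ i))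
  split-gap M i j ij jM = e1 , ≡-sym (ℕP.m∸n+n≡m (≤-trans (ℕP.m∸n≤m j i) jM)) ,
                       ℕP.m+n≤o⇒m≤o∸n i (subst (_≤ M) (≡-sym e1) jM)
    where e1 = ℕP.m+[n∸m]≡n ij

  shorter : ∀ M i j → i < j → j ≤ M → M ∸ (j ∸ i) < M
  shorter M i j ij jM = ℕP.∸-monoʳ-< {M} {j ∸ i} {0} (ℕP.m<n⇒0<n∸m ij) (≤-trans (ℕP.m∸n≤m j i) jM)

  module NoEars (ch : Chordal G) where
    NoEar : ℕ → Set
    NoEar M = Ear M → ⊥

    HasRepeat : ∀ {M} → Ear M → Set
    HasRepeat {M} e = ∃ λ j → j < suc M × ∃ λ i → i < j × Ear.f e i ≡ Ear.f e j

    HasChord : ∀ {M} → Ear M → Set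
    HasChord {M} e = ∃ λ j → j < suc M × ∃ λ i → i < j ×
                       (suc i < j × ¬ (i ≡ 0 × j ≡ M) × E (Ear.f e i) (Ear.f e j))

    repeat? : ∀ {M} (e : Ear M) → Dec (HasRepeat e)
    repeat? {M} e = anyUpTo? (λ j → anyUpTo? (λ i → Ear.f e i ≟F Ear.f e j) j) (suc M)

    chord? : ∀ {M} (e : Ear M) → Dec (HasChord e)
    chord? {M} e = anyUpTo? (λ j → anyUpTo? (λ i → chord-at? i j) j) (suc M)
      where
      chord-at? : ∀ i j → Dec (suc i < j × ¬ (i ≡ 0 × j ≡ M) × E (Ear.f e i) (Ear.f e j))
      chord-at? i j =
        (suc i <? j) ×-dec (¬? ((i ℕ.≟ 0) ×-dec (j ℕ.≟ M)) ×-dec (adj G (Ear.f e i) (Ear.f e j) ≟ᵇ true))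

    module _ {M} (IH : ∀ {m} → m < M → NoEar m) (e : Ear M) where
      open Ear e

      -- k = 2: the vertex f 1 ∉ B has the two distinct neighbours f 0 , f 2 in B.
      short-ear : k ≡ 2 → ⊥
      short-ear k≡2 = outside 1 ≤-refl (subst (1 <_) (≡-sym k≡2) ≤-refl) f₁∈B
        where
        2≤M : 2 ≤ M
        2≤M = subst (_≤ M) k≡2 k≤M
        f₁∈B : B (f 1)
        f₁∈B = closedB (f 1) (f 0) (f 2) (λ eq → f₀≢fₖ (trans eq (cong f (≡-sym k≡2)))) start∈B
               (tail∈B 2 (ℕP.≤-reflexive k≡2) 2≤M) (edge-sym G (edge 0 (<-≤-trans (s≤s z≤n) 2≤M))) (edge 1 2≤M)

      -- a repeated vertex f i = f j either violates the ear conditions or can be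
      -- cut out together with everything between its occurrences
      repeat-case : ∀ j → j ≤ M → ∀ i → i < j → f i ≡ f j → ⊥
      repeat-case j j≤M zero i<j eq with ℕP.<-cmp j k
      ... | tri< j<k _ _ = outside j i<j j<k (subst B eq start∈B)
      ... | tri≈ _ j≡k _ = f₀≢fₖ (trans eq (cong f j≡k))
      repeat-case (suc j') j≤M zero i<j eq | tri> _ _ k<j =
        IH j≤M (truncate e j' (ℕP.≤-trans (ℕP.n≤1+n j') j≤M) (ℕP.≤-pred k<j)
                 (subst (E (f j')) (≡-sym eq) (edge j' j≤M)))
      repeat-case j j≤M (suc i') i<j eq with split-gap M (suc i') j (<⇒≤ i<j) j≤M
      ... | e1 , M≡M'+d , i≤M' = body
        where
        i = suc i'
        d = j ∸ i
        M' = M ∸ d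
        bridge : i < M' → E (f i) (f (suc (i + d)))
        bridge lt = subst (λ x → E (f i) (f (suc x))) (≡-sym e1)
                  (subst (λ y → E y (f (suc j))) (≡-sym eq)
                    (edge j (subst (_< M) e1 (subst (i + d <_) (≡-sym M≡M'+d) (ℕP.+-monoˡ-< d lt)))))
        bridge-last : i ≡ M' → E (f i) (f 0)
        bridge-last ie = subst (λ y → E y (f 0))
          (≡-sym (trans eq (cong f (trans (≡-sym e1) (trans (cong (_+ d) ie) (≡-sym M≡M'+d)))))) closing
        open Shortcut e i d M' M≡M'+d i≤M' bridge bridge-last
        body : ⊥
        body with ℕP.≤-<-connex k i
        ... | inj₁ k≤i = IH (shorter M i j i<j j≤M) (shorten-after k≤i)
        ... | inj₂ i<k with ℕP.≤-<-connex k j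
        ...   | inj₁ k≤j = outside i (s≤s z≤n) i<k (subst B (≡-sym eq) (tail∈B j k≤j j≤M))
        ...   | inj₂ j<k = IH (shorter M i j i<j j≤M)
                  (shorten-before (k ∸ d) (≡-sym (ℕP.m∸n+n≡m (≤-trans (ℕP.m∸n≤m j i) (<⇒≤ j<k))))
                     ik (≤-trans (s≤s (s≤s z≤n)) ik))
          where
          ik : i < k ∸ d
          ik = ℕP.m+n≤o⇒m≤o∸n (suc i) (subst (λ x → suc x ≤ k) (≡-sym e1) j<k)

      -- a chord f i f j lets us cut out the vertices strictly between i and j
      chord-case : ¬ HasRepeat e → ∀ j → j ≤ M → ∀ i → suc i < j → ¬ (i ≡ 0 × j ≡ M) →
                   E (f i) (f j) → ⊥
      chord-case no-repeat j j≤M i si<j not-closing chord with split-gap M (suc i) j (<⇒≤ si<j) j≤M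
      ... | e1 , M≡M'+d , i<M' = body i refl
        where
        d = j ∸ suc i
        M' = M ∸ d
        i≤M' : i ≤ M'
        i≤M' = ≤-trans (ℕP.n≤1+n i) i<M'
        bridge : i < M' → E (f i) (f (suc (i + d)))
        bridge _ = subst (λ x → E (f i) (f x)) (≡-sym e1) chord
        bridge-last : i ≡ M' → E (f i) (f 0)
        bridge-last ie = ⊥-elim (ℕP.<-irrefl ie i<M')
        open Shortcut e i d M' M≡M'+d i≤M' bridge bridge-last
        k≡ : j < k → k ≡ (k ∸ d) + d
        k≡ j<k = ≡-sym (ℕP.m∸n+n≡m (≤-trans (ℕP.m∸n≤m j (suc i)) (<⇒≤ j<k)))
        M'<M : M' < M
        M'<M = shorter M (suc i) j si<j j≤M
        j<sM : j < suc M
        j<sM = s≤s j≤M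
        body : ∀ i' → i' ≡ i → ⊥
        body zero refl with ℕP.≤-<-connex k j
        ... | inj₁ k≤j =
          IH (ℕP.≤∧≢⇒< j≤M (λ jm → not-closing (refl , jm))) (truncate e j j≤M k≤j (edge-sym G chord))
        ... | inj₂ j<k = IH M'<M (shorten-before (k ∸ d) (k≡ j<k)
                              (<-≤-trans (s≤s z≤n) 2≤k') 2≤k')
          where
          2≤k' : 2 ≤ k ∸ d
          2≤k' = ℕP.m+n≤o⇒m≤o∸n 2 (subst (λ x → suc x ≤ k) (≡-sym e1) j<k)
        body (suc i') refl with ℕP.≤-<-connex k i
        ... | inj₁ k≤i = IH M'<M (shorten-after k≤i)
        ... | inj₂ i<k with ℕP.≤-<-connex k j
        ...   | inj₂ j<k = IH M'<M (shorten-before (k ∸ d) (k≡ j<k)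
                              ik (≤-trans (s≤s (s≤s z≤n)) ik))
          where
          ik : i < k ∸ d
          ik = ℕP.m+n≤o⇒m≤o∸n (suc i) (subst (_≤ k) (≡-sym e1) (<⇒≤ j<k))
        ...   | inj₁ k≤j = IH M'<M (shorten-at (s≤s z≤n) i<k (subst (k ≤_) (≡-sym e1) k≤j) i<M'
                              (λ eq → no-repeat (j , j<sM , 0 , <-≤-trans (s≤s z≤n) si<j ,
                                                 subst (λ x → f 0 ≡ f x) e1 eq)))

      -- without repeats and chords the ear is an induced cycle of length M + 1 ≥ 4
      cycle-case : 3 ≤ M → ¬ HasRepeat e → ¬ HasChord e → ⊥
      cycle-case 3≤M no-repeat no-chord =
        ch (suc M) (s≤s 3≤M) (cycle , cycle-injective , λ x y → edge⇒adjacent x y , adjacent⇒edge x y)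
        where
        cycle : Fin (suc M) → V
        cycle x = f (toℕ x)
        cycle-injective : ∀ {x y} → cycle x ≡ cycle y → x ≡ y
        cycle-injective {x} {y} eq with ℕP.<-cmp (toℕ x) (toℕ y)
        ... | tri< lt _ _ = ⊥-elim (no-repeat (toℕ y , toℕ<n y , toℕ x , lt , eq))
        ... | tri≈ _ q _ = toℕ-injective q
        ... | tri> _ _ gt = ⊥-elim (no-repeat (toℕ x , toℕ<n x , toℕ y , gt , ≡-sym eq))
        forward-edge⇒adjacent : ∀ (x y : Fin (suc M)) → toℕ x < toℕ y → E (cycle x) (cycle y) → CycAdj x y
        forward-edge⇒adjacent x y lt xy with suc (toℕ x) ℕ.≟ toℕ y
        ... | yes q = inj₁ (inj₁ (≡-sym q))
        ... | no q with toℕ x ℕ.≟ 0 | toℕ y ℕ.≟ M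
        ...   | yes x0 | yes yM = inj₂ (inj₂ (cong suc yM , x0))
        ...   | yes x0 | no yM =
          ⊥-elim (no-chord (toℕ y , toℕ<n y , toℕ x , lt , ℕP.≤∧≢⇒< lt q , (λ { (_ , b) → yM b }) , xy))
        ...   | no x0 | _ =
          ⊥-elim (no-chord (toℕ y , toℕ<n y , toℕ x , lt , ℕP.≤∧≢⇒< lt q , (λ { (a , _) → x0 a }) , xy))
        edge⇒adjacent : ∀ x y → E (cycle x) (cycle y) → CycAdj x y
        edge⇒adjacent x y xy with ℕP.<-cmp (toℕ x) (toℕ y)
        ... | tri< lt _ _ = forward-edge⇒adjacent x y lt xy
        ... | tri≈ _ q _ = ⊥-elim (edge-irrefl G (subst (λ z → E (f (toℕ x)) (f z)) (≡-sym q) xy) refl)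
        ... | tri> _ _ gt with forward-edge⇒adjacent y x gt (edge-sym G xy)
        ...   | inj₁ a = inj₂ a
        ...   | inj₂ a = inj₁ a
        next⇒edge : ∀ (x y : Fin (suc M)) → CycNext x y → E (cycle x) (cycle y)
        next⇒edge x y (inj₁ q) =
          subst (λ z → E (cycle x) (f z)) (≡-sym q) (edge (toℕ x) (ℕP.≤-pred (subst (_< suc M) q (toℕ<n y))))
        next⇒edge x y (inj₂ (q1 , q2)) = subst₂ (λ a b → E (f a) (f b)) (≡-sym (ℕP.suc-injective q1)) (≡-sym q2) closing
        adjacent⇒edge : ∀ x y → CycAdj x y → E (cycle x) (cycle y)
        adjacent⇒edge x y (inj₁ a) = next⇒edge x y a
        adjacent⇒edge x y (inj₂ a) = edge-sym G (next⇒edge y x a)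

    no-ear-step : ∀ M → (∀ {m} → m < M → NoEar m) → NoEar M
    no-ear-step M IH e with Ear.k e ℕ.≟ 2
    ... | yes k≡2 = short-ear IH e k≡2
    ... | no k≢2 with repeat? e
    ...   | yes (j , j< , i , i<j , eq) = repeat-case IH e j (ℕP.≤-pred j<) i i<j eq
    ...   | no no-repeat with chord? e
    ...     | yes (j , j< , i , _ , (si<j , not-closing , chord)) =
      chord-case IH e no-repeat j (ℕP.≤-pred j<) i si<j not-closing chord
    ...     | no no-chord =
      cycle-case IH e (≤-trans (ℕP.≤∧≢⇒< (Ear.2≤k e) (λ q → k≢2 (≡-sym q))) (Ear.k≤M e)) no-repeat no-chord

    no-ear : ∀ M → Ear M → ⊥
    no-ear = <-rec NoEar no-ear-step


-- The least
-- such set B is the closure of {x₀ , y₀} under threshold 2; it is connected, and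
-- a vertex outside it would, by 2-connectivity, yield an ear over B.
module Spreading {n} (G : Graph (suc n)) (tc : TwoConnected G) (ch : Chordal G)
                 {x₀ y₀ : Fin (suc n)} (x₀y₀ : Edge G x₀ y₀) where

  private
    θ₂ : Threshold (suc n)
    θ₂ _ = + 2

    seeds : Subset (suc n)
    seeds = ⁅ x₀ ⁆ ∪ ⁅ y₀ ⁆

    B : Subset (suc n)
    B = closure G θ₂ seeds

    InB : Fin (suc n) → Set
    InB z = z ∈ B

    seed-cases : ∀ {z} → z ∈ seeds → z ≡ x₀ ⊎ z ≡ y₀
    seed-cases z∈ with SubP.x∈p∪q⁻ ⁅ x₀ ⁆ ⁅ y₀ ⁆ z∈
    ... | inj₁ z∈x = inj₁ (SubP.x∈⁅y⁆⇒x≡y x₀ z∈x)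
    ... | inj₂ z∈y = inj₂ (SubP.x∈⁅y⁆⇒x≡y y₀ z∈y)

    x₀∈B : InB x₀
    x₀∈B = S-⊆-closure G θ₂ seeds (SubP.x∈p∪q⁺ (inj₁ (SubP.x∈⁅x⁆ x₀)))

    y₀∈B : InB y₀
    y₀∈B = S-⊆-closure G θ₂ seeds (SubP.x∈p∪q⁺ (inj₂ (SubP.x∈⁅x⁆ y₀)))

  B-closed : TwoNeighbourClosed G InB
  B-closed u p q p≢q p∈B q∈B up uq =
    closure-closed G θ₂ seeds u (two-active-neighbours G B p≢q up p∈B uq q∈B)

  B-least : (C : Fin (suc n) → Set) → TwoNeighbourClosed G C → C x₀ → C y₀ → ∀ {z} → InB z → C z
  B-least C closedC cx cy = closure-ind G θ₂ seeds C seed inherit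
    where
    seed : ∀ {u} → u ∈ seeds → C u
    seed u∈ with seed-cases u∈
    ... | inj₁ refl = cx
    ... | inj₂ refl = cy
    inherit : ∀ A u → A ⊆ B → (∀ {w} → w ∈ A → C w) → InB u → + 2 ℤ.≤ + ∣ N G u ∩ A ∣ → C u
    inherit A u _ allC _ enough with two-neighbours-in G A ℤP.≤-refl enough
    ... | p , q , p≢q , up , p∈ , uq , q∈ = closedC u p q p≢q (allC p∈) (allC q∈) up uq

  B-connected : ∀ {z} → InB z → ∃[ r ] WalkIn G InB z x₀ r
  B-connected = closure-ind G θ₂ seeds _ seed inherit
    where
    seed : ∀ {u} → u ∈ seeds → ∃[ r ] WalkIn G InB u x₀ r
    seed u∈ with seed-cases u∈
    ... | inj₁ refl = 0 , pnil x₀∈B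
    ... | inj₂ refl = 1 , pcons y₀∈B (edge-sym G x₀y₀) (pnil x₀∈B)
    inherit : ∀ A u → A ⊆ B → (∀ {w} → w ∈ A → ∃[ r ] WalkIn G InB w x₀ r) → InB u →
              + 2 ℤ.≤ + ∣ N G u ∩ A ∣ → ∃[ r ] WalkIn G InB u x₀ r
    inherit A u _ walks u∈B enough with neighbour-in G A (+≤+ (s≤s z≤n)) enough
    ... | p , up , p∈A = let (r , w) = walks p∈A in suc r , pcons u∈B up w

  open EarArgument G InB B-closed using (Ear; module NoEars)

  ear-from : ∀ {a u b m r} → Edge G a u → InB a → ¬ InB u → WalkTo G InB u b m → b ≢ a →
             WalkIn G InB b a r → ∃ Ear
  ear-from {m = zero} _ _ u∉B (oend u∈B) _ _ = ⊥-elim (u∉B u∈B)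
  ear-from {m = suc _} {r = zero} _ _ _ _ b≢a (pnil _) = ⊥-elim (b≢a refl)
  ear-from {a} {m = suc m'} {r = suc r'} au a∈B _ out b≢a back = m + r , record
      { f = f ; k = suc m ; 2≤k = s≤s (s≤s z≤n)
      ; k≤M = subst (suc m ≤_) (≡-sym (ℕP.+-suc m r')) (s≤s (ℕP.m≤m+n m r'))
      ; edge = λ t lt → vertexAt-edge G W t (ℕP.m<n⇒m<1+n lt)
      ; closing = subst (Edge G (f (m + r))) (vertexAt-end G W) (vertexAt-edge G W (m + r) ≤-refl)
      ; outside = outside ; start∈B = a∈B ; tail∈B = tail∈B ; f₀≢fₖ = f₀≢fₖ }
    where
    m = suc m'
    r = suc r'
    out-w = walkTo⇒walk G out
    back-w = walkIn⇒walk G back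
    W : Walk G a a (suc (m + r))
    W = cons au (_++ʷ_ G out-w back-w)
    f = vertexAt G W
    outside : ∀ t → 1 ≤ t → t < suc m → ¬ InB (f t)
    outside (suc t) _ (s≤s t<m) =
      subst (λ z → ¬ InB z) (≡-sym (vertexAt-++ˡ G out-w back-w t (<⇒≤ t<m))) (vertexAt-out G out t t<m)
    tail∈B : ∀ t → suc m ≤ t → t ≤ m + r → InB (f t)
    tail∈B (suc t) (s≤s m≤t) t<m+r = subst InB (≡-sym f-on-back) (vertexAt-in G back s s≤r)
      where
      s = t ∸ m
      m+s≡t : m + s ≡ t
      m+s≡t = ℕP.m+[n∸m]≡n m≤t
      s≤r : s ≤ r
      s≤r = ℕP.+-cancelˡ-≤ m s r (subst (_≤ m + r) (≡-sym m+s≡t) (ℕP.≤-trans (ℕP.n≤1+n t) t<m+r))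
      f-on-back : vertexAt G (_++ʷ_ G out-w back-w) t ≡ vertexAt G back-w s
      f-on-back =
        trans (cong (vertexAt G (_++ʷ_ G out-w back-w)) (≡-sym m+s≡t)) (vertexAt-++ʳ G out-w back-w s)
    f₀≢fₖ : f 0 ≢ f (suc m)
    f₀≢fₖ a≡ =
      b≢a (≡-sym (trans a≡ (trans (vertexAt-++ˡ G out-w back-w m ≤-refl) (vertexAt-end G out-w))))

  private
    other-B-vertex : ∀ a → ∃[ b ] (InB b × a ≢ b)
    other-B-vertex a with a ≟F x₀
    ... | yes refl = y₀ , y₀∈B , edge-irrefl G x₀y₀
    ... | no a≢x₀  = x₀ , x₀∈B , a≢x₀

    -- since G ─ a is connected, from u ≢ a one can re-enter B at a vertex b ≢ a
    -- along a walk avoiding a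
    re-entry : ∀ {a u} → a ≢ u → ∃[ b ] ∃[ m ] (b ≢ a × WalkTo G InB u b m)
    re-entry {a} {u} a≢u with other-B-vertex a
    ... | b' , b'∈B , a≢b'
      with first-hit (G ─ a) (λ i → SubP._∈?_ (punchIn a i) B)
             (proj₂ (proj₂ (proj₂ tc) a (punchOut a≢u) (punchOut a≢b')))
             (subst InB (≡-sym (punchIn-punchOut a≢b')) b'∈B)
    ...   | j , m , out = punchIn a j , m , punchInᵢ≢i a j ,
              subst (λ x → WalkTo G InB x (punchIn a j) m) (punchIn-punchOut a≢u) (walkTo-lift G a out)

  -- B is everything: otherwise an edge leaving B would give an ear.
  B-everything : ∀ z → InB z
  B-everything z with SubP._∈?_ z B
  ... | yes z∈B = z∈B
  ... | no z∉B with leaving-edge G (λ w → SubP._∈?_ w B) (proj₂ (proj₁ (proj₂ tc) x₀ z)) x₀∈B z∉B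
  ...   | a , u , a∈B , u∉B , au with re-entry (λ a≡u → u∉B (subst InB a≡u a∈B))
  ...     | b , m , b≢a , out with B-connected (walkTo-end G out) | B-connected a∈B
  ...       | _ , b→x₀ | _ , a→x₀ =
    ⊥-elim (NoEars.no-ear ch _ (proj₂ (ear-from au a∈B u∉B out b≢a (_++ⁱ_ G b→x₀ (reverseⁱ G a→x₀)))))

spread : ∀ {n} (G : Graph (suc n)) → TwoConnected G → Chordal G → (C : Fin (suc n) → Set) →
         TwoNeighbourClosed G C → ∀ {x₀ y₀} → Edge G x₀ y₀ → C x₀ → C y₀ → ∀ z → C z
spread G tc ch C closedC x₀y₀ cx cy z = B-least C closedC cx cy (B-everything z)
  where open Spreading G tc ch x₀y₀

≤2-cases : (z : ℤ) → z ℤ.≤ + 2 → z ℤ.≤ 0ℤ ⊎ z ≡ + 1 ⊎ z ≡ + 2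
≤2-cases -[1+ _ ] _ = inj₁ -≤+
≤2-cases (+ 0) _ = inj₁ (+≤+ z≤n)
≤2-cases (+ 1) _ = inj₂ (inj₁ refl)
≤2-cases (+ 2) _ = inj₂ (inj₂ refl)
≤2-cases (+ suc (suc (suc _))) (+≤+ (s≤s (s≤s ())))

module _ {n} (H : Graph n) (τ : Threshold n) where

  activated-freely : ∀ S u → τ u ℤ.≤ 0ℤ → u ∈ closure H τ S
  activated-freely S u τu≤0 = closure-closed H τ S u (ℤP.≤-trans τu≤0 (+≤+ z≤n))

  activated-by-one : ∀ S {u p} → τ u ℤ.≤ + 1 → Edge H u p → p ∈ closure H τ S → u ∈ closure H τ S
  activated-by-one S {u} τu≤1 up p∈ =
    closure-closed H τ S u (ℤP.≤-trans τu≤1 (one-active-neighbour H _ up p∈))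

  closure-two-closed : (∀ u → τ u ℤ.≤ + 2) → ∀ S → TwoNeighbourClosed H (_∈ closure H τ S)
  closure-two-closed τ≤2 S u p q p≢q p∈ q∈ up uq =
    closure-closed H τ S u (ℤP.≤-trans (τ≤2 u) (two-active-neighbours H _ p≢q up p∈ uq q∈))

  closure-∅-⊆-free : (∀ u → τ u ℤ.≤ + 2) →
    (∀ x y → Edge H x y → τ x ℤ.≤ 0ℤ → τ y ≢ + 1) →
    (∀ x y u → x ≢ y → τ x ℤ.≤ 0ℤ → τ y ℤ.≤ 0ℤ → Edge H u x → Edge H u y → ⊥) →
    ∀ {u} → u ∈ closure H τ Empty → τ u ℤ.≤ 0ℤ
  closure-∅-⊆-free τ≤2 no-free-next-to-one no-free-pair =
    closure-ind H τ Empty (λ u → τ u ℤ.≤ 0ℤ) (λ u∈∅ → ⊥-elim (SubP.∉⊥ u∈∅)) inherit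
    where
    inherit : ∀ A u → A ⊆ closure H τ Empty → (∀ {w} → w ∈ A → τ w ℤ.≤ 0ℤ) →
              u ∈ closure H τ Empty → τ u ℤ.≤ + ∣ N H u ∩ A ∣ → τ u ℤ.≤ 0ℤ
    inherit A u _ free _ enough with ≤2-cases (τ u) (τ≤2 u)
    ... | inj₁ τu≤0 = τu≤0
    ... | inj₂ (inj₁ τu≡1) with neighbour-in H A (ℤP.≤-reflexive (≡-sym τu≡1)) enough
    ...   | p , up , p∈A = ⊥-elim (no-free-next-to-one p u (edge-sym H up) (free p∈A) τu≡1)
    inherit A u _ free _ enough | inj₂ (inj₂ τu≡2)
      with two-neighbours-in H A (ℤP.≤-reflexive (≡-sym τu≡2)) enough
    ... | p , q , p≢q , up , p∈A , uq , q∈A = ⊥-elim (no-free-pair p q u p≢q (free p∈A) (free q∈A) up uq)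

  closure-of-small : (∀ u → + 2 ℤ.≤ τ u) → (S : Subset n) → (∀ {x y} → x ≢ y → x ∈ S → y ∈ S → ⊥) →
                     closure H τ S ≡ S
  closure-of-small 2≤τ S single = SubP.⊆-antisym
    (closure-ind H τ S (_∈ S) (λ u∈S → u∈S) inherit) (S-⊆-closure H τ S)
    where
    inherit : ∀ A u → A ⊆ closure H τ S → (∀ {w} → w ∈ A → w ∈ S) →
              u ∈ closure H τ S → τ u ℤ.≤ + ∣ N H u ∩ A ∣ → u ∈ S
    inherit A u _ A⊆S _ enough with two-neighbours-in H A (2≤τ u) enough
    ... | p , q , p≢q , _ , p∈A , _ , q∈A = ⊥-elim (single p≢q (A⊆S p∈A) (A⊆S q∈A))

edge-within-distance-two : ∀ {n} (G : Graph n) (C : Fin n → Set) → TwoNeighbourClosed G C →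
  ∀ {x y} → x ≢ y → C x → C y → DistLe G 2 x y → ∃[ a ] ∃[ b ] (Edge G a b × C a × C b)
edge-within-distance-two G C closedC x≢y cx cy (_ , _ , nil) = ⊥-elim (x≢y refl)
edge-within-distance-two G C closedC {x} {y} x≢y cx cy (_ , _ , cons xy nil) = x , y , xy , cx , cy
edge-within-distance-two G C closedC {x} {y} x≢y cx cy (_ , _ , cons {y = z} xz (cons zy nil)) =
  x , z , xz , cx , closedC z x y x≢y cx cy (edge-sym G xz) zy
edge-within-distance-two G C closedC x≢y cx cy (_ , s≤s (s≤s ()) , cons _ (cons _ (cons _ _)))

closure-full : ∀ {n} (G : Graph (suc n)) (θ : Threshold (suc n)) → TwoConnected G → Chordal G →
  (∀ u → θ u ℤ.≤ + 2) → ∀ S {x y} → Edge G x y → x ∈ closure G θ S → y ∈ closure G θ S →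
  closure G θ S ≡ Full
closure-full G θ tc ch θ≤2 S xy x∈ y∈ =
  all⇒Full _ (spread G tc ch (_∈ closure G θ S) (closure-two-closed G θ θ≤2 S) xy x∈ y∈)

∈J₀⁺ : ∀ {n} (θ : Threshold n) {u} → θ u ℤ.≤ 0ℤ → u ∈ J₀ θ
∈J₀⁺ θ θu≤0 = ∈-tabulate⁺ {f = λ u → θ u ℤ.≤ᵇ 0ℤ} (Equivalence.to T-≡ (ℤP.≤⇒≤ᵇ θu≤0))

∈J₀⁻ : ∀ {n} (θ : Threshold n) {u} → u ∈ J₀ θ → θ u ℤ.≤ 0ℤ
∈J₀⁻ θ u∈J₀ = ℤP.≤ᵇ⇒≤ (Equivalence.from T-≡ (∈-tabulate⁻ {f = λ u → θ u ℤ.≤ᵇ 0ℤ} u∈J₀))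

module _ {n} (G : Graph (suc n)) (θ : Threshold (suc n))
         (tc : TwoConnected G) (ch : Chordal G) (θ≤2 : ∀ u → θ u ℤ.≤ + 2) where

  ∅-target-of-G : Q₁ G θ ⊎ Q₂ G θ → closure G θ Empty ≡ Full
  ∅-target-of-G (inj₁ (x , y , x≢y , θx≤0 , θy≤0 , d≤2))
    with edge-within-distance-two G (_∈ closure G θ Empty) (closure-two-closed G θ θ≤2 Empty) x≢y
           (activated-freely G θ Empty x θx≤0) (activated-freely G θ Empty y θy≤0) d≤2
  ... | a , b , ab , a∈ , b∈ = closure-full G θ tc ch θ≤2 Empty ab a∈ b∈
  ∅-target-of-G (inj₂ (x , y , xy , θx≤0 , θy≡1)) =
    closure-full G θ tc ch θ≤2 Empty xy x∈ (activated-by-one G θ Empty (ℤP.≤-reflexive θy≡1) (edge-sym G xy) x∈)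
    where x∈ = activated-freely G θ Empty x θx≤0

  closure-∅-of-G : ¬ Q₁ G θ → ¬ Q₂ G θ → closure G θ Empty ≡ J₀ θ
  closure-∅-of-G ¬Q₁ ¬Q₂ = SubP.⊆-antisym
    (λ u∈ → ∈J₀⁺ θ (closure-∅-⊆-free G θ θ≤2 no-Q₂ no-Q₁ u∈))
    (λ {u} u∈J₀ → activated-freely G θ Empty u (∈J₀⁻ θ u∈J₀))
    where
    no-Q₂ : ∀ x y → Edge G x y → θ x ℤ.≤ 0ℤ → θ y ≢ + 1
    no-Q₂ x y xy θx≤0 θy≡1 = ¬Q₂ (x , y , xy , θx≤0 , θy≡1)
    no-Q₁ : ∀ x y u → x ≢ y → θ x ℤ.≤ 0ℤ → θ y ℤ.≤ 0ℤ → Edge G u x → Edge G u y → ⊥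
    no-Q₁ x y u x≢y θx≤0 θy≤0 ux uy =
      ¬Q₁ (x , y , x≢y , θx≤0 , θy≤0 , 2 , ≤-refl , cons (edge-sym G ux) (cons uy nil))

module _ {n} (H : Graph n) (τ : Threshold n) where

  ∅-optimal : IsTarget H τ Empty → Optimal H τ Empty
  ∅-optimal ∅-target = ∅-target , λ S _ → subst (_≤ ∣ S ∣) (≡-sym (SubP.∣⊥∣≡0 n)) z≤n

  optimal-is-∅ : IsTarget H τ Empty → ∀ {S} → Optimal H τ S → S ≡ Empty
  optimal-is-∅ ∅-target {S} (_ , minimal) =
    ∣p∣≡0⇒p≡∅ S (ℕP.n≤0⇒n≡0 (subst (∣ S ∣ ≤_) (SubP.∣⊥∣≡0 n) (minimal Empty ∅-target)))

  singleton-optimal : ¬ IsTarget H τ Empty → ∀ {x} → IsTarget H τ ⁅ x ⁆ → Optimal H τ ⁅ x ⁆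
  singleton-optimal ∅-not-target {x} x-target = x-target , minimal
    where
    minimal : ∀ S → IsTarget H τ S → ∣ ⁅ x ⁆ ∣ ≤ ∣ S ∣
    minimal S S-target with ∣ S ∣ in ∣S∣≡
    ... | zero  = ⊥-elim (∅-not-target (subst (IsTarget H τ) (∣p∣≡0⇒p≡∅ S ∣S∣≡) S-target))
    ... | suc _ = subst (_≤ suc _) (≡-sym (SubP.∣⁅x⁆∣≡1 x)) (s≤s z≤n)

some-vertex : ∀ {m} → 3 ≤ suc m → Fin m
some-vertex (s≤s (s≤s _)) = zero

first-edge : ∀ {n} {G : Graph n} {x y k} → x ≢ y → Walk G x y k → ∃[ w ] Edge G x w
first-edge x≢y nil = ⊥-elim (x≢y refl)
first-edge _ (cons {y = w} xw _) = w , xw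

emb-∈⁺ : ∀ {n} (v : Fin (suc n)) (S : Subset n) {i} → i ∈ S → punchIn v i ∈ emb v S
emb-∈⁺ v S {i} i∈S = ∈-tabulate⁺ {f = λ j → embAt v S j (v ≟F j)} (embAt-punchIn (v ≟F punchIn v i))
  where
  embAt-punchIn : (d : Dec (v ≡ punchIn v i)) → embAt v S (punchIn v i) d ≡ true
  embAt-punchIn (yes v≡) = ⊥-elim (punchInᵢ≢i v i (≡-sym v≡))
  embAt-punchIn (no v≢) = trans (cong (lookup S) (trans (punchOut-cong v refl) (punchOut-punchIn v))) ([]=⇒lookup i∈S)

emb-∈⁻ : ∀ {n} (v : Fin (suc n)) (S : Subset n) {z} → z ∈ emb v S → ∃[ i ] (punchIn v i ≡ z × i ∈ S)
emb-∈⁻ v S {z} z∈ = from-embAt (v ≟F z) (∈-tabulate⁻ {f = λ j → embAt v S j (v ≟F j)} z∈)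
  where
  from-embAt : (d : Dec (v ≡ z)) → embAt v S z d ≡ true → ∃[ i ] (punchIn v i ≡ z × i ∈ S)
  from-embAt (yes _) ()
  from-embAt (no v≢z) eq = punchOut v≢z , punchIn-punchOut v≢z , lookup⇒[]= _ S eq

emb-single : ∀ {n} (v : Fin (suc n)) (S : Subset n) → ∣ S ∣ ≤ 1 →
             ∀ {a b} → a ≢ b → a ∈ emb v S → b ∈ emb v S → ⊥
emb-single v S ∣S∣≤1 a≢b a∈ b∈ with emb-∈⁻ v S a∈ | emb-∈⁻ v S b∈
... | i , refl , i∈S | j , refl , j∈S =
  ℕP.<-irrefl refl (ℕP.≤-trans (two≤∣p∣ (λ i≡j → a≢b (cong (punchIn v) i≡j)) i∈S j∈S) ∣S∣≤1)

module Removal {n} (G : Graph (suc n)) (θ : Threshold (suc n))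
               (tc : TwoConnected G) (ch : Chordal G) (θ≤2 : ∀ u → θ u ℤ.≤ + 2) (v : Fin (suc n)) where

  private
    H = G ─ v
    τ = θ₁ G θ v

  θ₁-cases : ∀ i → (Edge G v (punchIn v i) × τ i ≡ θ (punchIn v i) - 1ℤ) ⊎
                   (¬ Edge G v (punchIn v i) × τ i ≡ θ (punchIn v i))
  θ₁-cases i with adj G v (punchIn v i)
  ... | true  = inj₁ (refl , refl)
  ... | false = inj₂ ((λ ()) , refl)

  τ≤θ : ∀ i → τ i ℤ.≤ θ (punchIn v i)
  τ≤θ i with θ₁-cases i
  ... | inj₁ (_ , τi≡) = subst (ℤ._≤ θ (punchIn v i)) (≡-sym τi≡) (ℤP.i-j≤i (θ (punchIn v i)) 1ℤ)
  ... | inj₂ (_ , τi≡) = ℤP.≤-reflexive τi≡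

  θ-1≤τ : ∀ i → θ (punchIn v i) - 1ℤ ℤ.≤ τ i
  θ-1≤τ i with θ₁-cases i
  ... | inj₁ (_ , τi≡) = ℤP.≤-reflexive (≡-sym τi≡)
  ... | inj₂ (_ , τi≡) = subst (θ (punchIn v i) - 1ℤ ℤ.≤_) (≡-sym τi≡) (ℤP.i-j≤i (θ (punchIn v i)) 1ℤ)

  τ≤2 : ∀ i → τ i ℤ.≤ + 2
  τ≤2 i = ℤP.≤-trans (τ≤θ i) (θ≤2 (punchIn v i))

  τ≤1-next-to-v : ∀ i → Edge G v (punchIn v i) → τ i ℤ.≤ + 1
  τ≤1-next-to-v i vi with θ₁-cases i
  ... | inj₁ (_ , τi≡) = subst (ℤ._≤ + 1) (≡-sym τi≡) (ℤP.+-monoˡ-≤ (ℤ.- 1ℤ) (θ≤2 (punchIn v i)))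
  ... | inj₂ (¬vi , _) = ⊥-elim (¬vi vi)

  -- Since v counts for exactly the threshold drop of θ₁, lifted
  -- vertices form a two-neighbour-closed set of G.
  Lifted : Subset n → Fin (suc n) → Set
  Lifted S z = z ≡ v ⊎ ∃[ i ] (punchIn v i ≡ z × i ∈ closure H τ S)

  lifted : ∀ S {i} → i ∈ closure H τ S → Lifted S (punchIn v i)
  lifted S {i} i∈ = inj₂ (i , refl , i∈)

  lifted-closed : ∀ S → TwoNeighbourClosed G (Lifted S)
  lifted-closed S u p q p≢q p↑ q↑ up uq with v ≟F u
  ... | yes v≡u = inj₁ (≡-sym v≡u)
  ... | no v≢u = inj₂ (punchOut v≢u , punchIn-punchOut v≢u , active p↑ q↑)
    where
    i = punchOut v≢u
    at-u : ∀ {z} → Edge G u z → Edge G (punchIn v i) z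
    at-u = subst (λ y → Edge G y _) (≡-sym (punchIn-punchOut v≢u))
    one-via-v : ∀ {p q} → Edge G u p → Edge G u q → p ≡ v →
                (∃[ j ] (punchIn v j ≡ q × j ∈ closure H τ S)) → i ∈ closure H τ S
    one-via-v up uq refl (j , refl , j∈) =
      activated-by-one H τ S (τ≤1-next-to-v i (edge-sym G (at-u up))) (at-u uq) j∈
    active : Lifted S p → Lifted S q → i ∈ closure H τ S
    active (inj₁ p≡v) (inj₁ q≡v) = ⊥-elim (p≢q (trans p≡v (≡-sym q≡v)))
    active (inj₁ p≡v) (inj₂ q↑)  = one-via-v up uq p≡v q↑
    active (inj₂ p↑)  (inj₁ q≡v) = one-via-v uq up q≡v p↑
    active (inj₂ (j , refl , j∈)) (inj₂ (l , refl , l∈)) =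
      closure-two-closed H τ τ≤2 S i j l (λ j≡l → p≢q (cong (punchIn v) j≡l)) j∈ l∈ (at-u up) (at-u uq)

  target-from-edge : ∀ S {a b} → Edge G a b → Lifted S a → Lifted S b → IsTarget H τ S
  target-from-edge S ab a↑ b↑ =
    all⇒Full _ λ i → unlift (spread G tc ch (Lifted S) (lifted-closed S) ab a↑ b↑ (punchIn v i))
    where
    unlift : ∀ {i} → Lifted S (punchIn v i) → i ∈ closure H τ S
    unlift {i} (inj₁ i≡v) = ⊥-elim (punchInᵢ≢i v i i≡v)
    unlift {i} (inj₂ (j , j≡i , j∈)) = subst (_∈ closure H τ S) (punchIn-injective v j i j≡i) j∈

  -- If ∅ is a target set of H it is the only optimal one, so ∅ ∈ 𝓕.
  ∅-in-F : IsTarget H τ Empty → InF G θ v Empty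
  ∅-in-F ∅-target = ∅-optimal H τ ∅-target , λ S opt →
    ℕP.≤-reflexive (cong (λ X → ∣ N G v ∩ closure G θ (emb v X) ∣) (optimal-is-∅ H τ ∅-target opt))

  -- (a): a free neighbour of v in H, together with v, forms a lifted edge.
  part-a : INvNonempty G θ v → InF G θ v Empty
  part-a (x , vx , x∈I) =
    ∅-in-F (target-from-edge Empty vx (inj₁ refl) (lifted Empty (activated-freely H τ Empty x x∈I)))

  -- (b): two free vertices at distance ≤ 2 give a lifted edge.
  part-b : P₁ G θ v → InF G θ v Empty
  part-b (x , y , x≢y , x∈I , y∈I , d≤2)
    with edge-within-distance-two G (Lifted Empty) (lifted-closed Empty) (λ e → x≢y (punchIn-injective v x y e))
           (lifted Empty (activated-freely H τ Empty x x∈I)) (lifted Empty (activated-freely H τ Empty y y∈I)) d≤2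
  ... | a , b , ab , a↑ , b↑ = ∅-in-F (target-from-edge Empty ab a↑ b↑)

  -- (c): a free vertex activates its neighbour of threshold 1, giving a lifted edge.
  part-c : P₂ G θ v → InF G θ v Empty
  part-c (x , y , xy , x∈I , τy≡1) = ∅-in-F (target-from-edge Empty xy (lifted Empty x∈) (lifted Empty y∈))
    where
    x∈ = activated-freely H τ Empty x x∈I
    y∈ = activated-by-one H τ Empty (ℤP.≤-reflexive τy≡1) (edge-sym H xy) x∈

  -- v has a neighbour: G is connected and has a vertex other than v.
  v-neighbour : ∃[ i ] Edge G v (punchIn v i)
  v-neighbour with proj₁ (proj₂ tc) v (punchIn v (some-vertex (proj₁ tc)))
  ... | _ , walk with first-edge (λ v≡ → punchInᵢ≢i v _ (≡-sym v≡)) walk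
  ...   | w , vw = punchOut v≢w , subst (Edge G v) (≡-sym (punchIn-punchOut v≢w)) vw
    where v≢w = edge-irrefl G vw

  -- (d): all thresholds are 2, so ∅ is no target set of H, v with x spreads over
  -- H, and in G a single seed activates nothing further.
  part-d : ¬ (∃[ u ] InJ θ u) → ∀ x → Edge G v (punchIn v x) →
           InF G θ v ⁅ x ⁆ × closure G θ ⁅ punchIn v x ⁆ ≡ ⁅ punchIn v x ⁆
  part-d ¬J x vx = (singleton-optimal H τ ∅-not-target x-target , most-activated) ,
                   closure-of-small G θ 2≤θ _ (⁅⁆-single (punchIn v x))
    where
    2≤θ : ∀ u → + 2 ℤ.≤ θ u
    2≤θ u = ℤP.≮⇒≥ (λ θu<2 → ¬J (u , θu<2))
    τ-positive : ∀ i → ¬ τ i ℤ.≤ 0ℤ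
    τ-positive i τi≤0 with ℤP.≤-trans (ℤP.+-monoˡ-≤ (ℤ.- 1ℤ) (2≤θ (punchIn v i))) (ℤP.≤-trans (θ-1≤τ i) τi≤0)
    ... | +≤+ ()
    ∅-not-target : ¬ IsTarget H τ Empty
    ∅-not-target ∅-target = τ-positive i (closure-∅-⊆-free H τ τ≤2
      (λ y _ _ τy≤0 _ → τ-positive y τy≤0) (λ y _ _ _ τy≤0 _ _ _ → τ-positive y τy≤0) (Full⇒∈ ∅-target i))
      where i = proj₁ v-neighbour
    x-target : IsTarget H τ ⁅ x ⁆
    x-target = target-from-edge ⁅ x ⁆ vx (inj₁ refl) (lifted ⁅ x ⁆ (S-⊆-closure H τ ⁅ x ⁆ (SubP.x∈⁅x⁆ x)))
    most-activated : ∀ S → Optimal H τ S →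
      ∣ N G v ∩ closure G θ (emb v S) ∣ ≤ ∣ N G v ∩ closure G θ (emb v ⁅ x ⁆) ∣
    most-activated S (_ , minimal) = ≤-trans at-most-one at-least-one
      where
      ∣S∣≤1 : ∣ S ∣ ≤ 1
      ∣S∣≤1 = subst (∣ S ∣ ≤_) (SubP.∣⁅x⁆∣≡1 x) (minimal ⁅ x ⁆ x-target)
      at-most-one : ∣ N G v ∩ closure G θ (emb v S) ∣ ≤ 1
      at-most-one = ≤-trans (SubP.∣p∩q∣≤∣q∣ (N G v) _)
        (subst (λ X → ∣ X ∣ ≤ 1) (≡-sym (closure-of-small G θ 2≤θ _ (emb-single v S ∣S∣≤1)))
          (∣p∣≤1 _ (emb-single v S ∣S∣≤1)))
      at-least-one : 1 ≤ ∣ N G v ∩ closure G θ (emb v ⁅ x ⁆) ∣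
      at-least-one = one≤∣p∣ (SubP.x∈p∩q⁺ (∈N⁺ G vx , S-⊆-closure G θ _ (emb-∈⁺ v ⁅ x ⁆ (SubP.x∈⁅x⁆ x))))

  -- (e): no free vertex of H is near v, another free vertex or one of threshold
  -- 1, so ∅ is no target set of H; x with its neighbour w of threshold ≤ 1
  -- spreads over H and over G.
  part-e : (∃[ u ] InJ θ u) → ¬ INvNonempty G θ v → ¬ P₁ G θ v → ¬ P₂ G θ v →
           ∀ x w → InJ θ w → Edge G (punchIn v x) w →
           InF G θ v ⁅ x ⁆ × closure G θ ⁅ punchIn v x ⁆ ≡ Full
  part-e _ ¬I ¬P₁ ¬P₂ x w w∈J xw = (singleton-optimal H τ ∅-not-target x-target , most-activated) ,
                                   spreads-from-x (S-⊆-closure G θ _ (SubP.x∈⁅x⁆ _))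
    where
    θw≤1 : θ w ℤ.≤ + 1
    θw≤1 = ℤP.i<j⇒i≤pred[j] w∈J
    spreads-from-x : ∀ {S} → punchIn v x ∈ closure G θ S → closure G θ S ≡ Full
    spreads-from-x x∈ = closure-full G θ tc ch θ≤2 _ xw x∈ (activated-by-one G θ _ θw≤1 (edge-sym G xw) x∈)
    x∈ : x ∈ closure H τ ⁅ x ⁆
    x∈ = S-⊆-closure H τ ⁅ x ⁆ (SubP.x∈⁅x⁆ x)
    w-lifted : Lifted ⁅ x ⁆ w
    w-lifted with v ≟F w
    ... | yes v≡w = inj₁ (≡-sym v≡w)
    ... | no v≢w = inj₂ (punchOut v≢w , w≡ , activated-by-one H τ ⁅ x ⁆ τ≤1 wx x∈)
      where
      w≡ = punchIn-punchOut v≢w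
      τ≤1 = ℤP.≤-trans (τ≤θ (punchOut v≢w)) (subst (λ z → θ z ℤ.≤ + 1) (≡-sym w≡) θw≤1)
      wx = subst (λ z → Edge G z (punchIn v x)) (≡-sym w≡) (edge-sym G xw)
    x-target : IsTarget H τ ⁅ x ⁆
    x-target = target-from-edge ⁅ x ⁆ xw (lifted ⁅ x ⁆ x∈) w-lifted
    ∅-not-target : ¬ IsTarget H τ Empty
    ∅-not-target ∅-target = ¬I (i , vi , closure-∅-⊆-free H τ τ≤2 no-P₂ no-P₁ (Full⇒∈ ∅-target i))
      where
      i = proj₁ v-neighbour
      vi = proj₂ v-neighbour
      no-P₂ : ∀ y z → Edge H y z → τ y ℤ.≤ 0ℤ → τ z ≢ + 1
      no-P₂ y z yz τy≤0 τz≡1 = ¬P₂ (y , z , yz , τy≤0 , τz≡1)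
      no-P₁ : ∀ y z u → y ≢ z → τ y ℤ.≤ 0ℤ → τ z ℤ.≤ 0ℤ → Edge H u y → Edge H u z → ⊥
      no-P₁ y z u y≢z τy≤0 τz≤0 uy uz =
        ¬P₁ (y , z , y≢z , τy≤0 , τz≤0 , 2 , ≤-refl , cons (edge-sym G uy) (cons uz nil))
    most-activated : ∀ S → Optimal H τ S →
      ∣ N G v ∩ closure G θ (emb v S) ∣ ≤ ∣ N G v ∩ closure G θ (emb v ⁅ x ⁆) ∣
    most-activated S _ = SubP.p⊆q⇒∣p∣≤∣q∣ (∩-⊆ʳ (N G v) λ {z} _ →
      Full⇒∈ (spreads-from-x (S-⊆-closure G θ _ (emb-∈⁺ v ⁅ x ⁆ (SubP.x∈⁅x⁆ x)))) z)

lemma12 : ∀ {n} (G : Graph (suc n)) (θ : Threshold (suc n)) →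
          TwoConnected G → Chordal G → (∀ u → θ u ℤ.≤ + 2) →
          (v : Fin (suc n)) →
          -- (a)
          (INvNonempty G θ v → InF G θ v Empty) ×
          -- (b)
          (¬ INvNonempty G θ v → P₁ G θ v → InF G θ v Empty) ×
          -- (c)
          (¬ INvNonempty G θ v → P₂ G θ v → InF G θ v Empty) ×
          -- (d)
          ((¬ (∃[ u ] InJ θ u)) → ∀ (x : Fin n) → Edge G v (punchIn v x) →
             InF G θ v ⁅ x ⁆ × closure G θ ⁅ punchIn v x ⁆ ≡ ⁅ punchIn v x ⁆) ×
          -- (e)
          ((∃[ u ] InJ θ u) → ¬ INvNonempty G θ v → ¬ P₁ G θ v → ¬ P₂ G θ v →
             ∀ (x : Fin n) (w : Fin (suc n)) → InJ θ w → Edge G (punchIn v x) w →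
             InF G θ v ⁅ x ⁆ × closure G θ ⁅ punchIn v x ⁆ ≡ Full) ×
          -- (f)
          (Q₁ G θ ⊎ Q₂ G θ → closure G θ Empty ≡ Full) ×
          -- (g)
          (¬ Q₁ G θ → ¬ Q₂ G θ → closure G θ Empty ≡ J₀ θ)
lemma12 G θ tc ch θ≤2 v =
  part-a , (λ _ → part-b) , (λ _ → part-c) , part-d , part-e ,
  ∅-target-of-G G θ tc ch θ≤2 , closure-∅-of-G G θ tc ch θ≤2
  where open Removal G θ tc ch θ≤2 v
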